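{- Let $\mathcal{G}$ be a rooted temporal tree in which every edge is associated with exactly one time interval, and run Algorithm A (described in the context) on $\mathcal{G}$. Then for every node $v$, the set $F_v$ computed for $v$ is a maximum feasible set for $T_v$ with respect to the sets $M_{u_i}$, $u_i\in child(v)$, computed by the algorithm.
   Context: A temporal graph has a finite node set and a finite edge set; each edge joins two distinct nodes (at most one per pair) and is associated with a nonempty list of time intervals $[s_1,f_1),\dots,[s_k,f_k)$ of integers with $0\le s_1<f_1<s_2<\dots<s_k<f_k\le\mathcal{T}$, existing at each integer timestep in one of them. A rooted temporal tree is a temporal graph whose underlying static graph is a tree with a designated root $r$; $P(v)$ is the parent, $child(v)$ the children, depth the distance from $r$, $T_v$ the temporal subtree on $v$ and its descendants, $e_{xy}$ the edge between $x,y$. Two distinct edges overlap if they share an endpoint and exist at a common timestep; a 0-1 timed matching is a set of edges no two of which overlap. $MaxNOS(S)$ is some maximum-cardinality non-overlapping subset of an edge set $S$. Given sets $M_{u_i}$ for the children $u_i$ of $v$: a maximum allowable set for $T_v$ is a maximum-cardinality set $A$ of edges from $v$ to its children such that $A\cup\bigcup_i M_{u_i}$ is a 0-1 timed matching for $T_v$; a maximum feasible set is a maximum allowable set $A$ with $A\cup\{e_{vP(v)}\}$ a 0-1 timed matching, if such exists (and $v\ne r$), otherwise an arbitrary maximum allowable set. (For a leaf $x$, $F_x=\emptyset$.) Algorithm A: process nodes in non-increasing order of depth. For a leaf $u$: $M_u:=\emptyset$, $F_u:=\emptyset$. For non-leaf $v$ with children $u_1,\dots,u_k$: $TM1[v]:=\bigcup_i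 M_{u_i}$; let $\tilde{\mathcal{R}}_0(v)$ be the set of $e_{vu_i}$ overlapping no edge of $M_{u_i}$; if $\tilde{\mathcal{R}}_0(v)=\emptyset$ then $F_v:=\emptyset$; else if $v=r$ then $F_v:=MaxNOS(\tilde{\mathcal{R}}_0(v))$; else with $\tilde{\mathcal{R}}^P_0(v):=\tilde{\mathcal{R}}_0(v)\cup\{e_{vP(v)}\}$, $F_v:=MaxNOS(\tilde{\mathcal{R}}^P_0(v))\setminus\{e_{vP(v)}\}$ if $|MaxNOS(\tilde{\mathcal{R}}^P_0(v))|>|MaxNOS(\tilde{\mathcal{R}}_0(v))|$, else $F_v:=MaxNOS(\tilde{\mathcal{R}}_0(v))$; $TM2[v]:=\emptyset$ if $F_v=\emptyset$ else $TM1[v]\cup F_v$; $M_v:=$ the larger of $TM1[v],TM2[v]$. Output $M_r$. -}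

module Defs where

open import Data.Nat using (ℕ; zero; suc; _≤_; _<_; _⊔_; _<ᵇ_)
open import Data.Nat.Properties using (_≟_; _<?_; m≤m⊔n; m≤n⊔m; ⊔-lub; ≤-<-trans)
open import Data.Bool using (Bool; true; false; if_then_else_)
open import Data.Maybe using (Maybe; just; nothing)
open import Data.Product using (_×_; _,_; proj₁; proj₂; Σ; ∃; ∃-syntax)
open import Data.Sum using (_⊎_; inj₁; inj₂)
open import Data.List using (List; []; _∷_; _∷ʳ_; _++_; length; concat; concatMap; filter; null; map)
open import Data.Unit using (⊤)
open import Data.List.Relation.Unary.All using (All; all?)
open import Data.List.Membership.Propositional using (_∈_)
open import Data.List.Relation.Unary.Unique.Propositional using (Unique)
open import Data.List.Relation.Binary.Subset.Propositional using (_⊆_)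
import Data.List.Properties as LP
import Data.Product.Properties as PP
open import Relation.Binary.PropositionalEquality using (_≡_; refl)
open import Relation.Nullary using (¬_; Dec; yes; no; ¬?)
open import Relation.Nullary.Decidable using (_×-dec_; _⊎-dec_)
open import Relation.Binary.Definitions using (DecidableEquality)

-- A node is given by the list of its children; each child comes with the
-- single interval [s , f) of the edge joining it to its parent.

data Tree : Set where
  node : List (ℕ × ℕ × Tree) → Tree

-- Nodes are addressed by paths from the root r = [] (list of child
-- indices, root first).  The edge e_{v u} from v to its i-th child
-- u = v ∷ʳ i is represented by the pair (v , i).
Path : Set
Path = List ℕ

Edge : Set
Edge = Path × ℕ

_≟P_ : DecidableEquality Path
_≟P_ = LP.≡-dec _≟_

_≟E_ : DecidableEquality Edge
_≟E_ = PP.≡-dec _≟P_ _≟_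

upper : Edge → Path
upper (p , i) = p

lower : Edge → Path
lower (p , i) = p ∷ʳ i

nth : List (ℕ × ℕ × Tree) → ℕ → Maybe (ℕ × ℕ × Tree)
nth []       _       = nothing
nth (c ∷ cs) zero    = just c
nth (c ∷ cs) (suc i) = nth cs i

subtreeAt : Tree → Path → Maybe Tree
subtreeAt t [] = just t
subtreeAt (node cs) (i ∷ p) with nth cs i
... | nothing = nothing
... | just (s , f , t) = subtreeAt t p

interval : Tree → Edge → Maybe (ℕ × ℕ)
interval T (p , i) with subtreeAt T p
... | nothing = nothing
... | just (node cs) with nth cs i
...   | nothing = nothing
...   | just (s , f , _) = just (s , f)

IsEdge : Tree → Edge → Set
IsEdge T e = ∃[ s ] ∃[ f ] interval T e ≡ just (s , f)

ActiveAt : Tree → Edge → ℕ → Set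
ActiveAt T e t = ∃[ s ] ∃[ f ] (interval T e ≡ just (s , f) × s ≤ t × t < f)

WF : Tree → Set
WF T = ∀ e s f → interval T e ≡ just (s , f) → s < f

ShareEnd : Edge → Edge → Set
ShareEnd e e' = (upper e ≡ upper e' ⊎ upper e ≡ lower e')
              ⊎ (lower e ≡ upper e' ⊎ lower e ≡ lower e')

Overlap : Tree → Edge → Edge → Set
Overlap T e e' = ¬ (e ≡ e') × ShareEnd e e' × ∃[ t ] (ActiveAt T e t × ActiveAt T e' t)

NonOverlapping : Tree → List Edge → Set
NonOverlapping T S = ∀ {e e'} → e ∈ S → e' ∈ S → ¬ Overlap T e e'

Matching : Tree → List Edge → Set
Matching T S = All (IsEdge T) S × NonOverlapping T S

-- X is a maximum-cardinality non-overlapping subset of S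
-- (finite sets are duplicate-free lists; cardinality = length)
IsMaxNOS : Tree → List Edge → List Edge → Set
IsMaxNOS T S X = Unique X × X ⊆ S × NonOverlapping T X
  × (∀ Y → Unique Y → Y ⊆ S → NonOverlapping T Y → length Y ≤ length X)

private
  commonTime? : (s f s' f' : ℕ) →
    Dec (∃[ t ] ((s ≤ t × t < f) × (s' ≤ t × t < f')))
  commonTime? s f s' f' with (s ⊔ s') <? f | (s ⊔ s') <? f'
  ... | yes a | yes b = yes (s ⊔ s' , (m≤m⊔n s s' , a) , (m≤n⊔m s s' , b))
  ... | no ¬a | _ = no λ { (t , (st , tf) , (s't , _)) → ¬a (≤-<-trans (⊔-lub st s't) tf) }
  ... | yes _ | no ¬b = no λ { (t , (st , _) , (s't , tf')) → ¬b (≤-<-trans (⊔-lub st s't) tf') }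

  active? : ∀ T e e' → Dec (∃[ t ] (ActiveAt T e t × ActiveAt T e' t))
  active? T e e' with interval T e | interval T e'
  ... | nothing | _ = no λ { (_ , (_ , _ , () , _) , _) }
  ... | just _ | nothing = no λ { (_ , _ , (_ , _ , () , _)) }
  ... | just (s , f) | just (s' , f') with commonTime? s f s' f'
  ...   | yes (t , (a , b) , (c , d)) = yes (t , (s , f , refl , a , b) , (s' , f' , refl , c , d))
  ...   | no ¬c = no λ { (t , (_ , _ , refl , a , b) , (_ , _ , refl , c , d)) → ¬c (t , (a , b) , (c , d)) }

overlap? : ∀ T e e' → Dec (Overlap T e e')
overlap? T e e' =
  ¬? (e ≟E e') ×-dec
  (((upper e ≟P upper e') ⊎-dec (upper e ≟P lower e'))
    ⊎-dec ((lower e ≟P upper e') ⊎-dec (lower e ≟P lower e')))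
  ×-dec active? T e e'

-- Since M_v depends only on the results for the children of v, processing
-- nodes in non-increasing order of depth is the same as this bottom-up
-- structural recursion.

module AlgorithmA (T : Tree) (MaxNOS : List Edge → List Edge) where

  -- F_v, given the parent edge e_{vP(v)} (nothing iff v = r) and R̃₀(v)
  Fcalc : Maybe Edge → List Edge → List Edge
  Fcalc _ [] = []
  Fcalc nothing R0@(_ ∷ _) = MaxNOS R0
  Fcalc (just eP) R0@(_ ∷ _) =
    if length (MaxNOS R0) <ᵇ length (MaxNOS (eP ∷ R0))
    then filter (λ e → ¬? (e ≟E eP)) (MaxNOS (eP ∷ R0))
    else MaxNOS R0

  -- data of a non-leaf node v from the list of pairs (e_{v u_i} , M_{u_i})
  R0 : List (Edge × List Edge) → List Edge
  R0 ds = map proj₁ (filter (λ d → all? (λ e' → ¬? (overlap? T (proj₁ d) e')) (proj₂ d)) ds)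

  TM1 : List (Edge × List Edge) → List Edge
  TM1 ds = concatMap proj₂ ds

  Fstep : Maybe Edge → List (Edge × List Edge) → List Edge
  Fstep par ds = Fcalc par (R0 ds)

  Mstep : Maybe Edge → List (Edge × List Edge) → List Edge
  Mstep par ds =
    let F = Fstep par ds
        TM2 = if null F then [] else TM1 ds ++ F
    in if length (TM1 ds) <ᵇ length TM2 then TM2 else TM1 ds

  mutual
    childData : Path → ℕ → List (ℕ × ℕ × Tree) → List (Edge × List Edge)
    childData v i [] = []
    childData v i ((s , f , t) ∷ cs) =
      ((v , i) , Msub (just (v , i)) (v ∷ʳ i) t) ∷ childData v (suc i) cs

    Msub : Maybe Edge → Path → Tree → List Edge
    Msub par v (node []) = []
    Msub par v (node cs@(_ ∷ _)) = Mstep par (childData v 0 cs)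

  Fsub : Maybe Edge → Path → Tree → List Edge
  Fsub par v (node []) = []
  Fsub par v (node cs@(_ ∷ _)) = Fstep par (childData v 0 cs)

  childMs : Path → Tree → List (List Edge)
  childMs v (node cs) = map proj₂ (childData v 0 cs)

parentEdge : Path → Maybe Edge
parentEdge [] = nothing
parentEdge (i ∷ p) with parentEdge p
... | nothing = just ([] , i)
... | just (q , j) = just (i ∷ q , j)

ChildEdge : Tree → Path → Edge → Set
ChildEdge T v e = upper e ≡ v × IsEdge T e

Allowable : Tree → Path → List (List Edge) → List Edge → Set
Allowable T v Ms A =
  Unique A × All (ChildEdge T v) A × Matching T (A ++ concat Ms)

MaxAllowable : Tree → Path → List (List Edge) → List Edge → Set
MaxAllowable T v Ms A = Allowable T v Ms A
  × (∀ B → Allowable T v Ms B → length B ≤ length A)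

MaxFeasible : Tree → Path → List (List Edge) → List Edge → Set
MaxFeasible T v Ms A = MaxAllowable T v Ms A × Extra (parentEdge v)
  where
  Extra : Maybe Edge → Set
  Extra nothing = ⊤
  Extra (just eP) =
    (∃[ A' ] (MaxAllowable T v Ms A' × Matching T (eP ∷ A'))) → Matching T (eP ∷ A)

-- Bottom-up, every M_u is a matching of the subtree T_u.  Edges lying in the
-- subtrees of two different children of v share no endpoint, so for a set A of
-- edges from v to its children, A ∪ ⋃ M_{u_i} is a matching exactly when A is
-- non-overlapping and each e_{v u_i} ∈ A overlaps nothing in its own M_{u_i},
-- i.e. when A is a non-overlapping subset of R̃₀(v).  Maximum allowable sets are
-- therefore the maximum non-overlapping subsets of R̃₀(v).  If adding the parent
-- edge e_{vP(v)} raises that maximum, a maximum non-overlapping subset of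
-- R̃₀(v) ∪ {e_{vP(v)}} contains e_{vP(v)}, and removing it leaves a maximum
-- allowable set compatible with the parent edge; otherwise no maximum allowable
-- set is compatible with it, and the feasibility condition holds vacuously.
module Submission where

open import Defs

open import Data.Bool using (true; false; if_then_else_) renaming (T to IsTrue)
open import Data.Empty using (⊥-elim)
open import Data.List using (List; []; _∷_; _∷ʳ_; _++_; [_]; length; concat; filter; map; null)
open import Data.List.Membership.DecPropositional _≟E_ using (_∈?_)
open import Data.List.Membership.Propositional using (_∈_; _∉_)
open import Data.List.Membership.Propositional.Properties
  using (∈-map⁺; ∈-map⁻; ∈-++⁺ˡ; ∈-++⁺ʳ; ∈-++⁻; ∈-concat⁺′; ∈-concat⁻′; ∈-filter⁺; ∈-filter⁻)
import Data.List.Properties as List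
open import Data.List.Relation.Unary.All.Properties using (++⁺)
open import Data.List.Relation.Binary.Permutation.Propositional.Properties using (++-comm)
open import Data.List.Relation.Binary.Subset.Propositional using (_⊆_)
open import Data.List.Relation.Binary.Subset.Propositional.Properties using (∷⁺ʳ; ⊆-reflexive-↭)
open import Data.List.Relation.Unary.All as All using (All; []; _∷_; all?)
open import Data.List.Relation.Unary.Any using (here; there)
open import Data.List.Relation.Unary.Unique.Propositional using (Unique; []; _∷_)
import Data.List.Relation.Unary.Unique.Propositional.Properties as Unique
open import Data.Maybe using (Maybe; just; nothing)
open import Data.Nat using (ℕ; zero; suc; _+_; _≤_; _<_; z≤n; s≤s; _<ᵇ_)
open import Data.Nat.Properties
  using (_≟_; ≤-trans; ≤-reflexive; ≤-pred; <⇒≱; <ᵇ⇒<; <⇒<ᵇ; +-identityʳ; +-suc)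
open import Data.Product using (_×_; _,_; proj₁; proj₂; ∃-syntax)
open import Data.Sum using (_⊎_; inj₁; inj₂)
open import Data.Unit using (⊤; tt)
open import Function using (_∘′_)
open import Relation.Binary.PropositionalEquality using (_≡_; refl; sym; trans; cong; subst)
open import Relation.Nullary using (¬_; Dec; yes; no; ¬?)

Below : Path → Edge → Set
Below u e = ∃[ q ] upper e ≡ u ++ q

Endpoint : Edge → Path → Set
Endpoint e x = x ≡ upper e ⊎ x ≡ lower e

shareEnd⇒commonEndpoint : ∀ {e e'} → ShareEnd e e' → ∃[ x ] (Endpoint e x × Endpoint e' x)
shareEnd⇒commonEndpoint {e} (inj₁ (inj₁ p)) = upper e , inj₁ refl , inj₁ p
shareEnd⇒commonEndpoint {e} (inj₁ (inj₂ p)) = upper e , inj₁ refl , inj₂ p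
shareEnd⇒commonEndpoint {e} (inj₂ (inj₁ p)) = lower e , inj₂ refl , inj₁ p
shareEnd⇒commonEndpoint {e} (inj₂ (inj₂ p)) = lower e , inj₂ refl , inj₂ p

shareEnd-sym : ∀ {e e'} → ShareEnd e e' → ShareEnd e' e
shareEnd-sym (inj₁ (inj₁ p)) = inj₁ (inj₁ (sym p))
shareEnd-sym (inj₁ (inj₂ p)) = inj₂ (inj₁ (sym p))
shareEnd-sym (inj₂ (inj₁ p)) = inj₁ (inj₂ (sym p))
shareEnd-sym (inj₂ (inj₂ p)) = inj₂ (inj₂ (sym p))

overlap-sym : ∀ {T e e'} → Overlap T e e' → Overlap T e' e
overlap-sym (e≢e' , share , t , active , active') =
  (λ eq → e≢e' (sym eq)) , shareEnd-sym share , t , active' , active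

endpoint-below : ∀ {u e x} → Below u e → Endpoint e x → ∃[ q ] x ≡ u ++ q
endpoint-below (q , eq) (inj₁ refl) = q , eq
endpoint-below {u} {e = _ , k} (q , refl) (inj₂ refl) = q ++ [ k ] , List.++-assoc u q [ k ]

below-∷ʳ : ∀ v {i : ℕ} {e : Edge} → Below (v ∷ʳ i) e → Below v e
below-∷ʳ v {i} (q , eq) = i ∷ q , trans eq (List.++-assoc v [ i ] q)

upper-below : ∀ {v e} → upper e ≡ v → Below v e
upper-below {v} eq = [] , trans eq (sym (List.++-identityʳ v))

∷ʳ-++-injective : ∀ v {i j : ℕ} q q' → (v ∷ʳ i) ++ q ≡ (v ∷ʳ j) ++ q' → i ≡ j
∷ʳ-++-injective []      q q' eq = List.∷-injectiveˡ eq
∷ʳ-++-injective (_ ∷ v) q q' eq = ∷ʳ-++-injective v q q' (List.∷-injectiveʳ eq)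

≢-∷ʳ-++ : ∀ v {j : ℕ} q → ¬ v ≡ (v ∷ʳ j) ++ q
≢-∷ʳ-++ []      q ()
≢-∷ʳ-++ (_ ∷ v) q eq = ≢-∷ʳ-++ v q (List.∷-injectiveʳ eq)

below-siblings-disjoint : ∀ {v : Path} {i j : ℕ} {m m' : Edge}
  → ¬ i ≡ j → Below (v ∷ʳ i) m → Below (v ∷ʳ j) m' → ¬ ShareEnd m m'
below-siblings-disjoint {v} i≢j below below' share with shareEnd⇒commonEndpoint share
... | x , end , end' with endpoint-below below end | endpoint-below below' end'
... | q , eq | q' , eq' = i≢j (∷ʳ-++-injective v q q' (trans (sym eq) eq'))

childEdge-disjoint-below-sibling : ∀ {v : Path} {i j : ℕ} {m : Edge}
  → ¬ i ≡ j → Below (v ∷ʳ j) m → ¬ ShareEnd (v , i) m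
childEdge-disjoint-below-sibling {v} {i} i≢j below share with shareEnd⇒commonEndpoint share
... | x , inj₁ refl , end with endpoint-below below end
...   | q , eq = ≢-∷ʳ-++ v q eq
childEdge-disjoint-below-sibling {v} {i} i≢j below share | x , inj₂ refl , end with endpoint-below below end
...   | q , eq = i≢j (∷ʳ-++-injective v [] q (trans (List.++-identityʳ (v ∷ʳ i)) eq))

parentEdge≡nothing : ∀ p → parentEdge p ≡ nothing → p ≡ []
parentEdge≡nothing []      _ = refl
parentEdge≡nothing (i ∷ p) eq with parentEdge p
parentEdge≡nothing (i ∷ p) () | nothing
parentEdge≡nothing (i ∷ p) () | just _

lower-parentEdge : ∀ v {e} → parentEdge v ≡ just e → lower e ≡ v
lower-parentEdge (i ∷ p) eq with parentEdge p in eq'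
lower-parentEdge (i ∷ p) refl | nothing = cong (i ∷_) (sym (parentEdge≡nothing p eq'))
lower-parentEdge (i ∷ p) refl | just _  = cong (i ∷_) (lower-parentEdge p eq')

upper-parentEdge : ∀ v {e} → parentEdge v ≡ just e → ¬ upper e ≡ v
upper-parentEdge v {q , j} eq refl =
  ≢-∷ʳ-++ q [] (sym (trans (List.++-identityʳ (q ∷ʳ j)) (lower-parentEdge v eq)))

subtreeAt-child : ∀ T v {cs i s f t} → subtreeAt T v ≡ just (node cs) → nth cs i ≡ just (s , f , t)
  → subtreeAt T (v ∷ʳ i) ≡ just t
subtreeAt-child T [] refl eq rewrite eq = refl
subtreeAt-child (node cs) (j ∷ v) hv eq with nth cs j
subtreeAt-child (node cs) (j ∷ v) () eq | nothing
subtreeAt-child (node cs) (j ∷ v) hv eq | just (_ , _ , t) = subtreeAt-child t v hv eq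

interval-child : ∀ T v {cs i s f t} → subtreeAt T v ≡ just (node cs) → nth cs i ≡ just (s , f , t)
  → interval T (v , i) ≡ just (s , f)
interval-child T v hv eq rewrite hv | eq = refl

isEdge-child : ∀ T v {cs i} → subtreeAt T v ≡ just (node cs)
  → IsEdge T (v , i) → ∃[ c ] nth cs i ≡ just c
isEdge-child T v {cs} {i} hv (_ , _ , eq) rewrite hv with nth cs i
isEdge-child T v {cs} {i} hv (_ , _ , ()) | nothing
isEdge-child T v {cs} {i} hv _            | just c = c , refl

NonOverlappingSubset : Tree → List Edge → List Edge → Set
NonOverlappingSubset T S X = Unique X × X ⊆ S × NonOverlapping T X

nonOverlapping-⊆ : ∀ {T X Y} → X ⊆ Y → NonOverlapping T Y → NonOverlapping T X
nonOverlapping-⊆ X⊆Y noY x∈ y∈ = noY (X⊆Y x∈) (X⊆Y y∈)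

matching-⊆ : ∀ {T X Y} → X ⊆ Y → Matching T Y → Matching T X
matching-⊆ X⊆Y (edges , noY) =
  All.tabulate (λ x∈ → All.lookup edges (X⊆Y x∈)) , nonOverlapping-⊆ X⊆Y noY

⊆-[] : ∀ {X : List Edge} → X ⊆ [] → X ≡ []
⊆-[] {[]}    _   = refl
⊆-[] {_ ∷ _} sub with sub (here refl)
... | ()

⊆-∷-∉ : ∀ {e : Edge} {X S} → X ⊆ e ∷ S → e ∉ X → X ⊆ S
⊆-∷-∉ sub e∉X x∈ with sub x∈
... | here refl = ⊥-elim (e∉X x∈)
... | there x∈S = x∈S

deleteEdge : Edge → List Edge → List Edge
deleteEdge e = filter (λ x → ¬? (x ≟E e))

deleteEdge-⊆ : ∀ e {X} → deleteEdge e X ⊆ X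
deleteEdge-⊆ e x∈ = proj₁ (∈-filter⁻ (λ x → ¬? (x ≟E e)) x∈)

deleteEdge-nos : ∀ {T e S X}
  → NonOverlappingSubset T (e ∷ S) X → NonOverlappingSubset T S (deleteEdge e X)
deleteEdge-nos {e = e} {S} {X} (uX , X⊆e∷S , noX) =
  Unique.filter⁺ keep? uX , ⊆S , nonOverlapping-⊆ (deleteEdge-⊆ e) noX
  where
  keep? = λ x → ¬? (x ≟E e)
  ⊆S : deleteEdge e X ⊆ S
  ⊆S x∈ with ∈-filter⁻ keep? x∈
  ... | x∈X , x≢e with X⊆e∷S x∈X
  ...   | here x≡e  = ⊥-elim (x≢e x≡e)
  ...   | there x∈S = x∈S

deleteEdge-fresh : ∀ e {X} → All (λ x → ¬ e ≡ x) X → deleteEdge e X ≡ X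
deleteEdge-fresh e fresh =
  List.filter-all (λ x → ¬? (x ≟E e)) (All.map (λ e≢x x≡e → e≢x (sym x≡e)) fresh)

length-≤-suc-deleteEdge : ∀ e {X} → Unique X → length X ≤ suc (length (deleteEdge e X))
length-≤-suc-deleteEdge e {[]}    _            = z≤n
length-≤-suc-deleteEdge e {x ∷ X} (x∉X ∷ uX) with x ≟E e
... | yes refl = s≤s (≤-reflexive (cong length (sym (deleteEdge-fresh x x∉X))))
... | no _     = s≤s (length-≤-suc-deleteEdge e uX)

if-preserves : ∀ {A : Set} {P : A → Set} b {x y} → P x → P y → P (if b then x else y)
if-preserves true  px _  = px
if-preserves false _  py = py

module Correctness (T : Tree) (MaxNOS : List Edge → List Edge)
  (MaxNOS-spec : ∀ S → IsMaxNOS T S (MaxNOS S)) where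

  open AlgorithmA T MaxNOS

  MaxNOS-nos : ∀ S → NonOverlappingSubset T S (MaxNOS S)
  MaxNOS-nos S = let (uX , X⊆S , noX , _) = MaxNOS-spec S in uX , X⊆S , noX

  MaxNOS-max : ∀ S {Y} → NonOverlappingSubset T S Y → length Y ≤ length (MaxNOS S)
  MaxNOS-max S (uY , Y⊆S , noY) = proj₂ (proj₂ (proj₂ (MaxNOS-spec S))) _ uY Y⊆S noY

  Fcalc-nos : ∀ par R → NonOverlappingSubset T R (Fcalc par R)
  Fcalc-nos par      []        = [] , (λ ()) , λ ()
  Fcalc-nos nothing  R@(_ ∷ _) = MaxNOS-nos R
  Fcalc-nos (just e) R@(_ ∷ _) with length (MaxNOS R) <ᵇ length (MaxNOS (e ∷ R))
  ... | true  = deleteEdge-nos (MaxNOS-nos (e ∷ R))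
  ... | false = MaxNOS-nos R

  allowable-nonOverlapping : ∀ {v Ms B} → Allowable T v Ms B → NonOverlapping T B
  allowable-nonOverlapping (_ , _ , _ , noB) = nonOverlapping-⊆ ∈-++⁺ˡ noB

  allowable-edges : ∀ {v Ms B} → Allowable T v Ms B → All (IsEdge T) B
  allowable-edges (_ , childEdges , _) = All.map proj₂ childEdges

  FeasibleFor : Path → List (List Edge) → List Edge → Maybe Edge → Set
  FeasibleFor v Ms A nothing  = ⊤
  FeasibleFor v Ms A (just e) =
    (∃[ A' ] (MaxAllowable T v Ms A' × Matching T (e ∷ A'))) → Matching T (e ∷ A)

  maxFeasible-intro : ∀ v {Ms A}
    → MaxAllowable T v Ms A → FeasibleFor v Ms A (parentEdge v) → MaxFeasible T v Ms A
  maxFeasible-intro v max feasible with parentEdge v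
  ... | nothing = max , feasible
  ... | just _  = max , feasible

  record Candidates (v : Path) (Ms : List (List Edge)) (R : List Edge) : Set where
    field
      nos⇒allowable : ∀ {A} → NonOverlappingSubset T R A → Allowable T v Ms A
      allowable⇒⊆   : ∀ {B} → Allowable T v Ms B → B ⊆ R

  module _ {v Ms R} (candidates : Candidates v Ms R) where
    open Candidates candidates

    allowable-≤-MaxNOS : ∀ {B} → Allowable T v Ms B → length B ≤ length (MaxNOS R)
    allowable-≤-MaxNOS allowB =
      MaxNOS-max R (proj₁ allowB , allowable⇒⊆ allowB , allowable-nonOverlapping {Ms = Ms} allowB)

    MaxNOS-maxAllowable : MaxAllowable T v Ms (MaxNOS R)
    MaxNOS-maxAllowable = nos⇒allowable (MaxNOS-nos R) , λ _ → allowable-≤-MaxNOS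

    improving-parent : ∀ e → length (MaxNOS R) < length (MaxNOS (e ∷ R))
      → MaxAllowable T v Ms (deleteEdge e (MaxNOS (e ∷ R)))
        × FeasibleFor v Ms (deleteEdge e (MaxNOS (e ∷ R))) (just e)
    improving-parent e lt = (allowF , maxF) , feasible
      where
      X = MaxNOS (e ∷ R)
      F = deleteEdge e X
      allowF : Allowable T v Ms F
      allowF = nos⇒allowable (deleteEdge-nos (MaxNOS-nos (e ∷ R)))
      e∈X : e ∈ X
      e∈X with e ∈? X
      ... | yes e∈X = e∈X
      ... | no  e∉X = let (uX , X⊆e∷R , noX) = MaxNOS-nos (e ∷ R)
                      in ⊥-elim (<⇒≱ lt (MaxNOS-max R (uX , ⊆-∷-∉ X⊆e∷R e∉X , noX)))
      maxF : ∀ B → Allowable T v Ms B → length B ≤ length F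
      maxF B allowB = ≤-trans (allowable-≤-MaxNOS allowB)
        (≤-pred (≤-trans lt (length-≤-suc-deleteEdge e (proj₁ (MaxNOS-nos (e ∷ R))))))
      e∷F⊆X : e ∷ F ⊆ X
      e∷F⊆X (here refl) = e∈X
      e∷F⊆X (there x∈F) = deleteEdge-⊆ e x∈F
      feasible : FeasibleFor v Ms F (just e)
      feasible (_ , _ , (e-edge ∷ _) , _) = e-edge ∷ allowable-edges {Ms = Ms} allowF
                                          , nonOverlapping-⊆ e∷F⊆X (proj₂ (proj₂ (MaxNOS-nos (e ∷ R))))

    nonimproving-parent : ∀ e → e ∉ R → ¬ length (MaxNOS R) < length (MaxNOS (e ∷ R))
      → FeasibleFor v Ms (MaxNOS R) (just e)
    nonimproving-parent e e∉R ¬lt (A' , (allowA' , maxA') , (_ , noe∷A')) =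
      ⊥-elim (¬lt (≤-trans (s≤s (maxA' _ (proj₁ MaxNOS-maxAllowable)))
                           (MaxNOS-max (e ∷ R) (ue∷A' , ∷⁺ʳ e (allowable⇒⊆ allowA') , noe∷A'))))
      where
      ue∷A' : Unique (e ∷ A')
      ue∷A' = All.tabulate (λ x∈A' e≡x → e∉R (subst (_∈ R) (sym e≡x) (allowable⇒⊆ allowA' x∈A')))
            ∷ proj₁ allowA'

  Fcalc-maxFeasible : ∀ {v Ms} par R → Candidates v Ms R → (∀ {e} → par ≡ just e → e ∉ R)
    → MaxAllowable T v Ms (Fcalc par R) × FeasibleFor v Ms (Fcalc par R) par
  Fcalc-maxFeasible par [] candidates _ =
      (nos⇒allowable ([] , (λ ()) , λ ())
      , λ _ allowB → ≤-reflexive (cong length (⊆-[] (allowable⇒⊆ allowB))))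
    , feasible par
    where
    open Candidates candidates
    feasible : ∀ p → FeasibleFor _ _ [] p
    feasible nothing  = tt
    feasible (just e) (_ , _ , e∷A'-matching) =
      matching-⊆ (λ { (here refl) → here refl }) e∷A'-matching
  Fcalc-maxFeasible nothing R@(_ ∷ _) candidates _ = MaxNOS-maxAllowable candidates , tt
  Fcalc-maxFeasible (just e) R@(_ ∷ _) candidates e∉R
    with length (MaxNOS R) <ᵇ length (MaxNOS (e ∷ R)) in eq
  ... | true  = improving-parent candidates e (<ᵇ⇒< _ _ (subst IsTrue (sym eq) tt))
  ... | false = MaxNOS-maxAllowable candidates
              , nonimproving-parent candidates e (e∉R refl) (λ lt → subst IsTrue eq (<⇒<ᵇ lt))

  MatchingBelow : Path → List Edge → Set
  MatchingBelow u M = Matching T M × All (Below u) M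

  Compatible : Edge × List Edge → Set
  Compatible d = All (λ m → ¬ Overlap T (proj₁ d) m) (proj₂ d)

  compatible? : ∀ d → Dec (Compatible d)
  compatible? d = all? (λ m → ¬? (overlap? T (proj₁ d) m)) (proj₂ d)

  record ChildTable (v : Path) (ds : List (Edge × List Edge)) : Set where
    field
      childEdge     : ∀ {d} → d ∈ ds → ChildEdge T v (proj₁ d)
      functional    : ∀ {d d'} → d ∈ ds → d' ∈ ds → proj₁ d ≡ proj₁ d' → proj₂ d ≡ proj₂ d'
      complete      : ∀ {b} → ChildEdge T v b → ∃[ M ] ((b , M) ∈ ds)
      matchingBelow : ∀ {d} → d ∈ ds → MatchingBelow (lower (proj₁ d)) (proj₂ d)

  module _ {v ds} (table : ChildTable v ds) where
    open ChildTable table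

    private
      Ms : List (List Edge)
      Ms = map proj₂ ds

    ∈-children⁻ : ∀ {m} → m ∈ concat Ms → ∃[ d ] (d ∈ ds × m ∈ proj₂ d)
    ∈-children⁻ m∈ with ∈-concat⁻′ Ms m∈
    ... | M , m∈M , M∈Ms with ∈-map⁻ proj₂ M∈Ms
    ...   | d , d∈ds , refl = d , d∈ds , m∈M

    ∈-children⁺ : ∀ {d m} → d ∈ ds → m ∈ proj₂ d → m ∈ concat Ms
    ∈-children⁺ d∈ds m∈ = ∈-concat⁺′ m∈ (∈-map⁺ proj₂ d∈ds)

    child-view : ∀ {d} → d ∈ ds → ∃[ i ] ∃[ M ] d ≡ ((v , i) , M)
    child-view {(_ , i) , M} d∈ds with childEdge d∈ds
    ... | refl , _ = i , M , refl

    below-child : ∀ {i M m} → ((v , i) , M) ∈ ds → m ∈ M → Below (v ∷ʳ i) m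
    below-child d∈ds m∈M = All.lookup (proj₂ (matchingBelow d∈ds)) m∈M

    children-nonOverlapping : NonOverlapping T (concat Ms)
    children-nonOverlapping m∈ m'∈ with ∈-children⁻ m∈ | ∈-children⁻ m'∈
    ... | d , d∈ds , m∈d | d' , d'∈ds , m'∈d' with child-view d∈ds | child-view d'∈ds
    ... | i , M , refl | j , M' , refl with i ≟ j
    ... | yes refl =
      proj₂ (proj₁ (matchingBelow d∈ds)) m∈d (subst (_ ∈_) (sym (functional d∈ds d'∈ds refl)) m'∈d')
    ... | no i≢j   = λ overlapping →
      below-siblings-disjoint i≢j (below-child d∈ds m∈d) (below-child d'∈ds m'∈d') (proj₁ (proj₂ overlapping))

    children-matchingBelow : MatchingBelow v (concat Ms)
    children-matchingBelow = (All.tabulate edge , children-nonOverlapping) , All.tabulate below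
      where
      edge : ∀ {m} → m ∈ concat Ms → IsEdge T m
      edge m∈ with ∈-children⁻ m∈
      ... | d , d∈ds , m∈d = All.lookup (proj₁ (proj₁ (matchingBelow d∈ds))) m∈d
      below : ∀ {m} → m ∈ concat Ms → Below v m
      below {m} m∈ with ∈-children⁻ m∈
      ... | d , d∈ds , m∈d with child-view d∈ds
      ...   | i , M , refl = below-∷ʳ v {i} {m} (below-child d∈ds m∈d)

    ∈-R0⁻ : ∀ {e} → e ∈ R0 ds → ∃[ M ] ((e , M) ∈ ds × Compatible (e , M))
    ∈-R0⁻ e∈ with ∈-map⁻ proj₁ e∈
    ... | (e , M) , d∈filter , refl = M , ∈-filter⁻ compatible? d∈filter

    R0-childEdge : ∀ {e} → e ∈ R0 ds → ChildEdge T v e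
    R0-childEdge e∈ = let (_ , d∈ds , _) = ∈-R0⁻ e∈ in childEdge d∈ds

    R0-compatible : ∀ {a m} → a ∈ R0 ds → m ∈ concat Ms → ¬ Overlap T a m
    R0-compatible a∈ m∈ with ∈-R0⁻ a∈ | ∈-children⁻ m∈
    ... | M , d∈ds , compatible | d' , d'∈ds , m∈d' with child-view d∈ds | child-view d'∈ds
    ... | i , _ , refl | j , M' , refl with i ≟ j
    ... | yes refl = All.lookup compatible (subst (_ ∈_) (sym (functional d∈ds d'∈ds refl)) m∈d')
    ... | no i≢j   = λ overlapping →
      childEdge-disjoint-below-sibling i≢j (below-child d'∈ds m∈d') (proj₁ (proj₂ overlapping))

    R0-candidates : Candidates v Ms (R0 ds)
    R0-candidates = record { nos⇒allowable = nos⇒allowable ; allowable⇒⊆ = allowable⇒⊆ }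
      where
      nos⇒allowable : ∀ {A} → NonOverlappingSubset T (R0 ds) A → Allowable T v Ms A
      nos⇒allowable {A} (uA , A⊆R0 , noA) =
        uA , All.tabulate (R0-childEdge ∘′ A⊆R0) , All.tabulate edge , nonOverlapping
        where
        edge : ∀ {x} → x ∈ A ++ concat Ms → IsEdge T x
        edge x∈ with ∈-++⁻ A x∈
        ... | inj₁ x∈A  = proj₂ (R0-childEdge (A⊆R0 x∈A))
        ... | inj₂ x∈Ms = All.lookup (proj₁ (proj₁ children-matchingBelow)) x∈Ms
        nonOverlapping : NonOverlapping T (A ++ concat Ms)
        nonOverlapping x∈ y∈ with ∈-++⁻ A x∈ | ∈-++⁻ A y∈
        ... | inj₁ a∈ | inj₁ b∈ = noA a∈ b∈
        ... | inj₂ m∈ | inj₂ n∈ = children-nonOverlapping m∈ n∈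
        ... | inj₁ a∈ | inj₂ m∈ = R0-compatible (A⊆R0 a∈) m∈
        ... | inj₂ m∈ | inj₁ a∈ = R0-compatible (A⊆R0 a∈) m∈ ∘′ overlap-sym
      allowable⇒⊆ : ∀ {B} → Allowable T v Ms B → B ⊆ R0 ds
      allowable⇒⊆ {B} (_ , childEdges , _ , noB) b∈B with complete (All.lookup childEdges b∈B)
      ... | M , d∈ds = ∈-map⁺ proj₁ (∈-filter⁺ compatible? d∈ds (All.tabulate λ m∈M →
                         noB (∈-++⁺ˡ b∈B) (∈-++⁺ʳ B (∈-children⁺ d∈ds m∈M))))

    Fstep-maxFeasible : MaxFeasible T v Ms (Fstep (parentEdge v) ds)
    Fstep-maxFeasible =
      let (max , feasible) = Fcalc-maxFeasible (parentEdge v) (R0 ds) R0-candidates parentEdge∉R0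
      in maxFeasible-intro v max feasible
      where
      parentEdge∉R0 : ∀ {e} → parentEdge v ≡ just e → e ∉ R0 ds
      parentEdge∉R0 eq e∈ = upper-parentEdge v eq (proj₁ (R0-childEdge e∈))

    Mstep-matchingBelow : ∀ par → MatchingBelow v (Mstep par ds)
    Mstep-matchingBelow par =
      if-preserves {P = MatchingBelow v} (length (TM1 ds) <ᵇ length TM2)
        (if-preserves {P = MatchingBelow v} (null F) (([] , λ ()) , []) withF)
        children-matchingBelow
      where
      F = Fstep par ds
      TM2 = if null F then [] else TM1 ds ++ F
      nosF = Fcalc-nos par (R0 ds)
      withF : MatchingBelow v (concat Ms ++ F)
      withF = matching-⊆ (⊆-reflexive-↭ (++-comm (concat Ms) F))
                         (proj₂ (proj₂ (Candidates.nos⇒allowable R0-candidates nosF)))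
            , ++⁺ (proj₂ children-matchingBelow)
                  (All.tabulate λ {x} x∈F → upper-below {e = x} (proj₁ (R0-childEdge (proj₁ (proj₂ nosF) x∈F))))

  childDatum : Path → ℕ → ℕ × ℕ × Tree → Edge × List Edge
  childDatum v i (_ , _ , t) = (v , i) , Msub (just (v , i)) (v ∷ʳ i) t

  ∈-childData⁻ : ∀ v k cs {d} → d ∈ childData v k cs
    → ∃[ i ] ∃[ c ] (nth cs i ≡ just c × d ≡ childDatum v (k + i) c)
  ∈-childData⁻ v k (c ∷ cs) (here refl) =
    0 , c , refl , cong (λ i → childDatum v i c) (sym (+-identityʳ k))
  ∈-childData⁻ v k (c ∷ cs) (there d∈) with ∈-childData⁻ v (suc k) cs d∈
  ... | i , c' , eq , refl = suc i , c' , eq , cong (λ j → childDatum v j c') (sym (+-suc k i))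

  ∈-childData⁺ : ∀ v k cs {i c} → nth cs i ≡ just c → childDatum v (k + i) c ∈ childData v k cs
  ∈-childData⁺ v k (c ∷ cs) {zero}  refl rewrite +-identityʳ k = here refl
  ∈-childData⁺ v k (c ∷ cs) {suc i} eq rewrite +-suc k i = there (∈-childData⁺ v (suc k) cs eq)

  childData-table : ∀ {v cs} → subtreeAt T v ≡ just (node cs)
    → (∀ {d} → d ∈ childData v 0 cs → MatchingBelow (lower (proj₁ d)) (proj₂ d))
    → ChildTable v (childData v 0 cs)
  childData-table {v} {cs} hv matchingBelow = record
    { childEdge     = childEdge
    ; functional    = functional
    ; complete      = complete
    ; matchingBelow = matchingBelow
    }
    where
    childEdge : ∀ {d} → d ∈ childData v 0 cs → ChildEdge T v (proj₁ d)
    childEdge d∈ with ∈-childData⁻ v 0 cs d∈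
    ... | i , (s , f , t) , eq , refl = refl , s , f , interval-child T v hv eq
    functional : ∀ {d d'} → d ∈ childData v 0 cs → d' ∈ childData v 0 cs
      → proj₁ d ≡ proj₁ d' → proj₂ d ≡ proj₂ d'
    functional d∈ d'∈ same with ∈-childData⁻ v 0 cs d∈ | ∈-childData⁻ v 0 cs d'∈
    ... | i , c , eq , refl | j , c' , eq' , refl with same
    ... | refl with trans (sym eq) eq'
    ... | refl = refl
    complete : ∀ {b} → ChildEdge T v b → ∃[ M ] ((b , M) ∈ childData v 0 cs)
    complete {_ , i} (refl , isEdge) with isEdge-child T v hv isEdge
    ... | c , eq = _ , ∈-childData⁺ v 0 cs eq

  mutual
    childTable : ∀ {v cs} → subtreeAt T v ≡ just (node cs) → ChildTable v (childData v 0 cs)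
    childTable {v} {cs} hv =
      childData-table hv (All.lookup (childData-matchingBelow v 0 cs (subtreeAt-child T v hv)))

    Msub-matchingBelow : ∀ par v t → subtreeAt T v ≡ just t → MatchingBelow v (Msub par v t)
    Msub-matchingBelow par v (node [])      _  = ([] , λ ()) , []
    Msub-matchingBelow par v (node (_ ∷ _)) hv = Mstep-matchingBelow (childTable hv) par

    childData-matchingBelow : ∀ v k cs
      → (∀ {i s f t} → nth cs i ≡ just (s , f , t) → subtreeAt T (v ∷ʳ (k + i)) ≡ just t)
      → All (λ d → MatchingBelow (lower (proj₁ d)) (proj₂ d)) (childData v k cs)
    childData-matchingBelow v k [] _ = []
    childData-matchingBelow v k ((s , f , t) ∷ cs) subtree =
        Msub-matchingBelow (just (v , k)) (v ∷ʳ k) t (shift (+-identityʳ k) (subtree refl))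
      ∷ childData-matchingBelow v (suc k) cs (λ {i} eq → shift (+-suc k i) (subtree eq))
      where
      shift : ∀ {j j' t} → j ≡ j' → subtreeAt T (v ∷ʳ j) ≡ just t → subtreeAt T (v ∷ʳ j') ≡ just t
      shift refl h = h

  Fsub-maxFeasible : ∀ v t → subtreeAt T v ≡ just t
    → MaxFeasible T v (childMs v t) (Fsub (parentEdge v) v t)
  Fsub-maxFeasible v (node [])      hv = Fstep-maxFeasible (childTable hv)
  Fsub-maxFeasible v (node (_ ∷ _)) hv = Fstep-maxFeasible (childTable hv)

lemma3 : (T : Tree) → WF T
    → (MaxNOS : List Edge → List Edge) → (∀ S → IsMaxNOS T S (MaxNOS S))
    → ∀ v t → subtreeAt T v ≡ just t
    → MaxFeasible T v (AlgorithmA.childMs T MaxNOS v t)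
    (AlgorithmA.Fsub T MaxNOS (parentEdge v) v t)
lemma3 T _ MaxNOS MaxNOS-spec = Correctness.Fsub-maxFeasible T MaxNOS MaxNOS-spec
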